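{- For any integers $1\leq r\leq n$: (i) $\Xi(n)=\xi(n)$; (ii) $\Xi_r(n)=\xi(n-r+1)$; (iii) $\Xi_1(n)>\Xi_2(n)>\cdots>\Xi_{n-1}(n)=\Xi_n(n)=1$.
   Context: For $n\in\mathbb N$, $\xi(n)=\max\{t^{n-t}: t\in\{1,\dots,n\}\}$ (with $0^0=1$). A composition of $n$ is a tuple $\sigma=(s_1,\dots,s_r)$ of positive integers with sum $n$; $r=|\sigma|$ is its length. For tuples of positive integers $\tau=(t_1,\dots,t_r)$, $\sigma=(s_1,\dots,s_r)$ of equal length write $\tau\preceq\sigma$ if $t_i\leq s_i$ for all $i$, and set $\eta(\sigma,\tau)=\prod_i t_i^{s_i-t_i}$. Define $\xi(\sigma)=\max\{\eta(\sigma,\tau):\tau\preceq\sigma\}$, $\Xi(n)=\max\{\xi(\sigma):\sigma \text{ a composition of } n\}$, and $\Xi_r(n)=\max\{\xi(\sigma): \sigma\text{ a composition of } n,\ |\sigma|=r\}$. -}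

module Defs where

open import Data.Nat using (ℕ; _+_; _*_; _∸_; _^_; _≤_; _<_)
open import Data.List using (List; length; zipWith)
open import Data.Nat.ListAction using (sum; product)
open import Data.List.Relation.Unary.All using (All)
open import Data.List.Relation.Binary.Pointwise using (Pointwise)
open import Data.Product using (_×_; ∃-syntax)
open import Relation.Binary.PropositionalEquality using (_≡_)

IsMaxOf : (ℕ → Set) → ℕ → Set
IsMaxOf P m = P m × (∀ k → P k → k ≤ m)

IsXi : ℕ → ℕ → Set
IsXi n = IsMaxOf (λ k → ∃[ t ] (1 ≤ t × t ≤ n × t ^ (n ∸ t) ≡ k))

Composition : ℕ → List ℕ → Set
Composition n σ = All (1 ≤_) σ × sum σ ≡ n

_⪯_ : List ℕ → List ℕ → Set
τ ⪯ σ = Pointwise (λ t s → 1 ≤ t × t ≤ s) τ σ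

η : List ℕ → List ℕ → ℕ
η σ τ = product (zipWith (λ s t → t ^ (s ∸ t)) σ τ)

IsXiComp : List ℕ → ℕ → Set
IsXiComp σ = IsMaxOf (λ k → ∃[ τ ] (τ ⪯ σ × η σ τ ≡ k))

IsBigXi : ℕ → ℕ → Set
IsBigXi n = IsMaxOf (λ k → ∃[ σ ] (Composition n σ × IsXiComp σ k))

IsBigXiR : ℕ → ℕ → ℕ → Set
IsBigXiR r n = IsMaxOf (λ k → ∃[ σ ] (Composition n σ × length σ ≡ r × IsXiComp σ k))

-- Every η(σ, τ) with τ ⪯ σ is dominated by one power (1 + t) ^ e with t + e = Σ s_i − |σ|:
-- a product of two such powers is again one, because the smaller base may be raised to the
-- larger and its spare t moved into the exponent.  Hence ξ(σ) ≤ ξ(n − r + 1) for every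
-- composition of n of length r, with equality at (n − r + 1, 1, …, 1).  Monotonicity of ξ
-- gives (i); (iii) follows from ξ(m) < ξ(m + 1) for m ≥ 2, since t ^ (m − t) < t ^ (m + 1 − t)
-- when t ≥ 2, while ξ(m) = 1 < 2 ^ (m − 1) ≤ ξ(m + 1) when the maximum is attained at t = 1.
module Submission where

open import Defs
open import Data.Nat using (ℕ; zero; suc; _+_; _*_; _∸_; _^_; _⊔_; _≤_; _<_; z≤n; s≤s)
open import Data.Nat.Properties
open import Algebra.Properties.CommutativeSemigroup +-commutativeSemigroup using (x∙yz≈y∙xz)
open import Data.Nat.ListAction using (sum)
open import Data.List using (List; []; _∷_; length; replicate)
open import Data.List.Properties using (length-replicate)
open import Data.List.Relation.Unary.All using (_∷_)
import Data.List.Relation.Unary.All.Properties as All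
import Data.List.Relation.Binary.Pointwise as Pointwise
open import Data.List.Relation.Binary.Pointwise using ([]; _∷_)
open import Data.Product using (_×_; ∃-syntax; _,_)
open import Data.Sum using (inj₁; inj₂)
open import Relation.Binary.PropositionalEquality

IsMaxOf-unique : ∀ {P : ℕ → Set} {a b} → IsMaxOf P a → IsMaxOf P b → a ≡ b
IsMaxOf-unique (Pa , a-max) (Pb , b-max) = ≤-antisym (b-max _ Pa) (a-max _ Pb)

powMax : ℕ → ℕ → ℕ
powMax n zero    = 0
powMax n (suc k) = powMax n k ⊔ suc k ^ (n ∸ suc k)

ξ : ℕ → ℕ
ξ n = powMax n n

^≤powMax : ∀ n {k t} → 1 ≤ t → t ≤ k → t ^ (n ∸ t) ≤ powMax n k
^≤powMax n {zero}  (s≤s _) ()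
^≤powMax n {suc k} 1≤t t≤1+k with m≤n⇒m<n∨m≡n t≤1+k
... | inj₁ (s≤s t≤k) = ≤-trans (^≤powMax n 1≤t t≤k) (m≤m⊔n _ _)
... | inj₂ refl      = m≤n⊔m (powMax n k) _

powMax-attained : ∀ n k → ∃[ t ] (1 ≤ t × t ≤ suc k × t ^ (n ∸ t) ≡ powMax n (suc k))
powMax-attained n zero    = 1 , ≤-refl , ≤-refl , refl
powMax-attained n (suc k) with ⊔-sel (powMax n (suc k)) (suc (suc k) ^ (n ∸ suc (suc k)))
... | inj₂ eq = suc (suc k) , s≤s z≤n , ≤-refl , sym eq
... | inj₁ eq with powMax-attained n k
...   | t , 1≤t , t≤1+k , t^≡ = t , 1≤t , m≤n⇒m≤1+n t≤1+k , trans t^≡ (sym eq)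

ξ-isXi : ∀ d → IsXi (suc d) (ξ (suc d))
ξ-isXi d = powMax-attained (suc d) d , λ { _ (t , 1≤t , t≤ , refl) → ^≤powMax (suc d) 1≤t t≤ }

-- The bases are shifted by one, so that PowerBound d k says k ≤ t' ^ (1 + d − t') with 1 ≤ t'.
PowerBound : ℕ → ℕ → Set
PowerBound d k = ∃[ t ] ∃[ e ] (t + e ≡ d × k ≤ suc t ^ e)

PowerBound⇒≤ξ : ∀ {d k} → PowerBound d k → k ≤ ξ (suc d)
PowerBound⇒≤ξ {d} {k} (t , e , refl , k≤) = begin
  k                         ≤⟨ k≤ ⟩
  suc t ^ e                 ≡⟨ cong (suc t ^_) (sym (m+n∸m≡n t e)) ⟩
  suc t ^ (suc d ∸ suc t)   ≤⟨ ^≤powMax (suc d) (s≤s z≤n) (s≤s (m≤m+n t e)) ⟩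
  ξ (suc d)                 ∎
  where open ≤-Reasoning

ξ-PowerBound : ∀ d → PowerBound d (ξ (suc d))
ξ-PowerBound d with powMax-attained (suc d) d
... | suc t , _ , s≤s t≤d , t^≡ = t , d ∸ t , m+[n∸m]≡n t≤d , ≤-reflexive (sym t^≡)

PowerBound-monoˡ : ∀ {d d′ k} → d ≤ d′ → PowerBound d k → PowerBound d′ k
PowerBound-monoˡ {d′ = d′} d≤d′ (t , e , refl , k≤) =
  t , e + (d′ ∸ (t + e)) , trans (sym (+-assoc t e _)) (m+[n∸m]≡n d≤d′) ,
  ≤-trans k≤ (^-monoʳ-≤ (suc t) (m≤m+n e _))

ξ-mono : ∀ {m n} → m ≤ n → ξ (suc m) ≤ ξ (suc n)
ξ-mono m≤n = PowerBound⇒≤ξ (PowerBound-monoˡ m≤n (ξ-PowerBound _))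

^*^≤^ : ∀ {t u} e f → t ≤ u → suc t ^ e * suc u ^ f ≤ suc u ^ (t + e + f)
^*^≤^ {t} {u} e f t≤u = begin
  suc t ^ e * suc u ^ f        ≤⟨ *-monoˡ-≤ (suc u ^ f) (^-monoˡ-≤ e (s≤s t≤u)) ⟩
  suc u ^ e * suc u ^ f        ≤⟨ *-monoˡ-≤ (suc u ^ f) (^-monoʳ-≤ (suc u) (m≤n+m e t)) ⟩
  suc u ^ (t + e) * suc u ^ f  ≡⟨ sym (^-distribˡ-+-* (suc u) (t + e) f) ⟩
  suc u ^ (t + e + f)          ∎
  where open ≤-Reasoning

PowerBound-* : ∀ {a b x y} → PowerBound a x → PowerBound b y → PowerBound (a + b) (x * y)
PowerBound-* (t , e , refl , x≤) (u , f , refl , y≤) with ≤-total t u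
... | inj₁ t≤u = u , t + e + f , x∙yz≈y∙xz u (t + e) f ,
  ≤-trans (*-mono-≤ x≤ y≤) (^*^≤^ e f t≤u)
... | inj₂ u≤t = t , u + f + e , trans (cong (t +_) (+-comm (u + f) e)) (sym (+-assoc t e (u + f))) ,
  ≤-trans (*-mono-≤ x≤ y≤) (≤-trans (≤-reflexive (*-comm (suc t ^ e) (suc u ^ f))) (^*^≤^ f e u≤t))

⪯⇒length≤sum : ∀ {σ τ} → τ ⪯ σ → length σ ≤ sum σ
⪯⇒length≤sum []                   = z≤n
⪯⇒length≤sum ((1≤t , t≤s) ∷ τ⪯σ) = +-mono-≤ (≤-trans 1≤t t≤s) (⪯⇒length≤sum τ⪯σ)

η-PowerBound : ∀ {σ τ} → τ ⪯ σ → PowerBound (sum σ ∸ length σ) (η σ τ)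
η-PowerBound []                                    = 0 , 0 , refl , ≤-refl
η-PowerBound {suc s ∷ σ} {suc t ∷ τ} ((s≤s _ , s≤s t≤s) ∷ τ⪯σ) =
  subst (λ d → PowerBound d (η (suc s ∷ σ) (suc t ∷ τ))) (sym (+-∸-assoc s (⪯⇒length≤sum τ⪯σ)))
    (PowerBound-* (t , s ∸ t , m+[n∸m]≡n t≤s , ≤-refl) (η-PowerBound τ⪯σ))

η≤ξ : ∀ {σ τ} → τ ⪯ σ → η σ τ ≤ ξ (suc (sum σ ∸ length σ))
η≤ξ τ⪯σ = PowerBound⇒≤ξ (η-PowerBound τ⪯σ)

sum-replicate-1 : ∀ k → sum (replicate k 1) ≡ k
sum-replicate-1 zero    = refl
sum-replicate-1 (suc k) = cong suc (sum-replicate-1 k)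

η-replicate-1 : ∀ k → η (replicate k 1) (replicate k 1) ≡ 1
η-replicate-1 zero    = refl
η-replicate-1 (suc k) = cong (_+ 0) (η-replicate-1 k)

peak : ℕ → ℕ → List ℕ
peak k D = suc D ∷ replicate k 1

peak-composition : ∀ {k D n} → suc k + D ≡ n → Composition n (peak k D)
peak-composition {k} {D} refl =
  s≤s z≤n ∷ All.replicate⁺ k ≤-refl ,
  cong suc (trans (cong (D +_) (sum-replicate-1 k)) (+-comm D k))

peak-excess : ∀ k D → sum (peak k D) ∸ length (peak k D) ≡ D
peak-excess k D =
  trans (cong₂ (λ s l → D + s ∸ l) (sum-replicate-1 k) (length-replicate k)) (m+n∸n≡m D k)

peak-isXiComp : ∀ k D → IsXiComp (peak k D) (ξ (suc D))
peak-isXiComp k D with powMax-attained (suc D) D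
... | t , 1≤t , t≤ , t^≡ =
  (t ∷ replicate k 1 , (1≤t , t≤) ∷ Pointwise.replicate⁺ (≤-refl , ≤-refl) k , η-peak) ,
  λ { _ (τ , τ⪯ , refl) → subst (λ d → η (peak k D) τ ≤ ξ (suc d)) (peak-excess k D) (η≤ξ τ⪯) }
  where
  η-peak : t ^ (suc D ∸ t) * η (replicate k 1) (replicate k 1) ≡ ξ (suc D)
  η-peak = trans (cong (t ^ (suc D ∸ t) *_) (η-replicate-1 k)) (trans (*-identityʳ _) t^≡)

Ξᵣ-isMax : ∀ {n r} → 1 ≤ r → r ≤ n → IsBigXiR r n (ξ (suc (n ∸ r)))
Ξᵣ-isMax {n} {suc k} _ r≤n =
  (peak k (n ∸ suc k) , peak-composition (m+[n∸m]≡n r≤n) , cong suc (length-replicate k) ,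
   peak-isXiComp k (n ∸ suc k)) ,
  λ { _ (σ , (_ , sum≡n) , length≡r , (τ , τ⪯ , refl) , _) →
        subst (λ d → η σ τ ≤ ξ (suc d)) (cong₂ _∸_ sum≡n length≡r) (η≤ξ τ⪯) }

Ξ-isMax : ∀ n → IsBigXi (suc n) (ξ (suc n))
Ξ-isMax n = witness (Ξᵣ-isMax ≤-refl (s≤s z≤n)) , bound
  where
  witness : IsBigXiR 1 (suc n) (ξ (suc n)) → ∃[ σ ] (Composition (suc n) σ × IsXiComp σ (ξ (suc n)))
  witness ((σ , comp , _ , σ-max) , _) = σ , comp , σ-max
  bound : ∀ m → ∃[ σ ] (Composition (suc n) σ × IsXiComp σ m) → m ≤ ξ (suc n)
  bound _ ([] , (_ , ()) , _)
  bound _ (σ@(_ ∷ _) , (_ , sum≡) , (τ , τ⪯ , refl) , _) =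
    ≤-trans (η≤ξ τ⪯) (ξ-mono (≤-trans (∸-monoʳ-≤ (sum σ) (s≤s z≤n)) (≤-reflexive (cong (_∸ 1) sum≡))))

ξ-strict : ∀ d → ξ (2 + d) < ξ (3 + d)
ξ-strict d with powMax-attained (2 + d) (1 + d)
... | suc zero , _ , _ , 1^≡ = begin-strict
  ξ (2 + d)    ≡⟨ sym 1^≡ ⟩
  1 ^ (1 + d)  ≡⟨ ^-zeroˡ (1 + d) ⟩
  1            <⟨ s≤s (s≤s z≤n) ⟩
  2            ≤⟨ *-monoʳ-≤ 2 (m^n>0 2 d) ⟩
  2 ^ (1 + d)  ≤⟨ PowerBound⇒≤ξ (1 , 1 + d , refl , ≤-refl) ⟩
  ξ (3 + d)    ∎
  where open ≤-Reasoning
... | suc (suc t) , _ , s≤s (s≤s t≤d) , b^≡ = begin-strict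
  ξ (2 + d)        ≡⟨ sym b^≡ ⟩
  b ^ (d ∸ t)      <⟨ m<m*n (b ^ (d ∸ t)) b {{m^n≢0 b (d ∸ t)}} (s≤s (s≤s z≤n)) ⟩
  b ^ (d ∸ t) * b  ≡⟨ *-comm (b ^ (d ∸ t)) b ⟩
  b ^ suc (d ∸ t)  ≤⟨ PowerBound⇒≤ξ (suc t , suc (d ∸ t) , exponent , ≤-refl) ⟩
  ξ (3 + d)        ∎
  where
  open ≤-Reasoning
  b = suc (suc t)
  exponent : suc t + suc (d ∸ t) ≡ 2 + d
  exponent = cong suc (trans (+-suc t (d ∸ t)) (cong suc (m+[n∸m]≡n t≤d)))

ξ-excess-strict : ∀ {n j} → j + 2 ≤ n → ξ (suc (n ∸ suc j)) < ξ (suc (n ∸ j))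
ξ-excess-strict {suc zero}    {zero} (s≤s ())
ξ-excess-strict {suc (suc d)} {zero} _ = ξ-strict d
ξ-excess-strict {j = suc j} (s≤s j+2≤n) = ξ-excess-strict j+2≤n

Ξᵣ-strictlyDecreasing : ∀ {n j a b} → 1 ≤ j → j + 2 ≤ n →
                        IsBigXiR j n a → IsBigXiR (suc j) n b → b < a
Ξᵣ-strictlyDecreasing {n} {j} 1≤j j+2≤n Ξⱼ Ξⱼ₊₁ =
  subst₂ _<_ (IsMaxOf-unique (Ξᵣ-isMax (s≤s z≤n) 1+j≤n) Ξⱼ₊₁)
             (IsMaxOf-unique (Ξᵣ-isMax 1≤j (<⇒≤ 1+j≤n)) Ξⱼ)
             (ξ-excess-strict j+2≤n)
  where
  1+j≤n = <⇒≤ (subst (_≤ n) (+-comm j 2) j+2≤n)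

lemma2p8 : ∀ (n r : ℕ) → 1 ≤ r → r ≤ n →
    (∃[ m ] (IsBigXi n m × IsXi n m))
    × (∃[ m ] (IsBigXiR r n m × IsXi (n ∸ r + 1) m))
    × (∀ (j a b : ℕ) → 1 ≤ j → j + 2 ≤ n → IsBigXiR j n a → IsBigXiR (suc j) n b → b < a)
    × IsBigXiR n n 1
    × (2 ≤ n → IsBigXiR (n ∸ 1) n 1)
lemma2p8 zero    (suc _) _   ()
lemma2p8 (suc n) r       1≤r r≤n =
    (ξ (suc n) , Ξ-isMax n , ξ-isXi n)
  , (ξ (suc (suc n ∸ r)) , Ξᵣ-isMax 1≤r r≤n ,
     subst (λ m → IsXi m (ξ (suc (suc n ∸ r)))) (+-comm 1 (suc n ∸ r)) (ξ-isXi (suc n ∸ r)))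
  , (λ _ _ _ → Ξᵣ-strictlyDecreasing)
  -- ξ 1 and ξ 2 both compute to 1.
  , subst (λ d → IsBigXiR (suc n) (suc n) (ξ (suc d))) (n∸n≡0 n) (Ξᵣ-isMax (s≤s z≤n) ≤-refl)
  , λ { (s≤s 1≤n) → subst (λ d → IsBigXiR n (suc n) (ξ (suc d))) (m+n∸n≡m 1 n)
                                (Ξᵣ-isMax {suc n} {n} 1≤n (n≤1+n n)) }
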